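{- Let $n$ be an odd positive integer and let $Q_n=\{0,\dots,n-1\}$ with multiplication $i\cdot j=u$, where $u\in\mathbb Z_n$ is the unique element with $2u\equiv i+j\pmod n$. Then $(Q_n,\cdot)$ satisfies the $3$-cycle condition: for all $x,y,z\in Q_n$ with $|\{x,y,z\}|=3$ there exist $u,v,w\in Q_n$ with $u\cdot v=x$, $v\cdot w=y$ and $w\cdot u=z$. -}

module Defs where

open import Data.Nat using (ℕ; suc; _+_; _*_; _%_)
open import Data.Nat.DivMod using (_mod_)
open import Data.Fin using (Fin; toℕ)
open import Relation.Binary.PropositionalEquality using (_≡_)

-- For an odd positive n = 2k+1 we take Q_n = Fin (2k+1) = {0,…,n-1}.
-- Since 2 (k+1) = n + 1 ≡ 1 (mod n), the inverse of 2 mod n is k+1,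
-- so u = (k+1)(i+j) mod n.
mul : (k : ℕ) → Fin (suc (k + k)) → Fin (suc (k + k)) → Fin (suc (k + k))
mul k i j = ((suc k) * (toℕ i + toℕ j)) mod suc (k + k)

HalfSumSpec : (k : ℕ) → Fin (suc (k + k)) → Fin (suc (k + k)) → Fin (suc (k + k)) → Set
HalfSumSpec k i j u = (2 * toℕ u) % suc (k + k) ≡ (toℕ i + toℕ j) % suc (k + k)

{-# OPTIONS --safe #-}
-- Write a, b, c for x, y, z and compute in ℤ_n. The product halves the sum, so taking
-- u = a − b + c, v = b − c + a and w = c − a + b gives u · v = 2a / 2 = a, and the
-- other two equations are the same computation for the cyclic shifts of (a, b, c).
module Submission where

open import Defs
open import Data.Nat using (ℕ; suc; _+_; _*_; _%_; _∸_; NonZero)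
open import Data.Nat.Properties using (m+[n∸m]≡n)
open import Data.Nat.DivMod using (_mod_; m%n<n; %-distribˡ-+; %-distribˡ-*; [m+kn]%n≡m%n; m<n⇒m%n≡m)
open import Data.Nat.Tactic.RingSolver using (solve-∀)
open import Data.Fin using (Fin; toℕ)
open import Data.Fin.Properties using (toℕ-injective; toℕ-fromℕ<; toℕ<n; toℕ≤n)
open import Data.Product using (∃-syntax; _×_; _,_)
open import Relation.Binary.PropositionalEquality using (_≡_; _≢_; cong; cong₂; sym; module ≡-Reasoning)
open ≡-Reasoning

toℕ-mod : ∀ m n .{{_ : NonZero n}} → toℕ (m mod n) ≡ m % n
toℕ-mod m n = toℕ-fromℕ< (m%n<n m n)

[s*[m%n+p%n]]%n≡[s*[m+p]]%n : ∀ s m p n .{{_ : NonZero n}} →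
                              (s * (m % n + p % n)) % n ≡ (s * (m + p)) % n
[s*[m%n+p%n]]%n≡[s*[m+p]]%n s m p n = begin
  (s * (m % n + p % n)) % n               ≡⟨ %-distribˡ-* s (m % n + p % n) n ⟩
  (s % n * ((m % n + p % n) % n)) % n     ≡⟨ cong (λ t → (s % n * t) % n) (sym (%-distribˡ-+ m p n)) ⟩
  (s % n * ((m + p) % n)) % n             ≡⟨ sym (%-distribˡ-* s (m + p) n) ⟩
  (s * (m + p)) % n                       ∎

toℕ-mul-mod : ∀ k m p →
              toℕ (mul k (m mod suc (k + k)) (p mod suc (k + k))) ≡ (suc k * (m + p)) % suc (k + k)
toℕ-mul-mod k m p = begin
  toℕ (mul k (m mod n) (p mod n))                     ≡⟨ toℕ-mod (suc k * (toℕ (m mod n) + toℕ (p mod n))) n ⟩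
  (suc k * (toℕ (m mod n) + toℕ (p mod n))) % n       ≡⟨ cong₂ (λ s t → (suc k * (s + t)) % n) (toℕ-mod m n) (toℕ-mod p n) ⟩
  (suc k * (m % n + p % n)) % n                       ≡⟨ [s*[m%n+p%n]]%n≡[s*[m+p]]%n (suc k) m p n ⟩
  (suc k * (m + p)) % n                               ∎
  where n = suc (k + k)

half-double : ∀ k a q → (suc k * (a + a + q * suc (k + k))) % suc (k + k) ≡ a % suc (k + k)
half-double k a q = begin
  (suc k * (a + a + q * n)) % n     ≡⟨ cong (_% n) (half-double-identity k a q) ⟩
  (a + (a + suc k * q) * n) % n     ≡⟨ [m+kn]%n≡m%n a (a + suc k * q) n ⟩
  a % n                             ∎
  where
  n = suc (k + k)
  half-double-identity : ∀ k a q → suc k * (a + a + q * suc (k + k)) ≡ a + (a + suc k * q) * suc (k + k)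
  half-double-identity = solve-∀

parallelogram : (k : ℕ) → Fin (suc (k + k)) → Fin (suc (k + k)) → Fin (suc (k + k)) → Fin (suc (k + k))
parallelogram k x y z = (toℕ x + toℕ z + (suc (k + k) ∸ toℕ y)) mod suc (k + k)

mul-parallelogram : ∀ k (x y z : Fin (suc (k + k))) →
                    mul k (parallelogram k x y z) (parallelogram k y z x) ≡ x
mul-parallelogram k x y z = toℕ-injective (begin
  toℕ (mul k (parallelogram k x y z) (parallelogram k y z x)) ≡⟨ toℕ-mul-mod k (a + c + (n ∸ b)) (b + a + (n ∸ c)) ⟩
  (suc k * ((a + c + (n ∸ b)) + (b + a + (n ∸ c)))) % n      ≡⟨ cong (λ t → (suc k * t) % n) sum-of-corners ⟩
  (suc k * (a + a + 2 * n)) % n                               ≡⟨ half-double k a 2 ⟩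
  a % n                                                       ≡⟨ m<n⇒m%n≡m (toℕ<n x) ⟩
  a                                                           ∎)
  where
  n = suc (k + k)
  a = toℕ x
  b = toℕ y
  c = toℕ z
  regroup : ∀ a b c p q → (a + c + p) + (b + a + q) ≡ a + a + (b + p) + (c + q)
  regroup = solve-∀
  double : ∀ a n → a + a + n + n ≡ a + a + 2 * n
  double = solve-∀
  sum-of-corners : (a + c + (n ∸ b)) + (b + a + (n ∸ c)) ≡ a + a + 2 * n
  sum-of-corners = begin
    (a + c + (n ∸ b)) + (b + a + (n ∸ c))   ≡⟨ regroup a b c (n ∸ b) (n ∸ c) ⟩
    a + a + (b + (n ∸ b)) + (c + (n ∸ c))   ≡⟨ cong₂ (λ s t → a + a + s + t) (m+[n∸m]≡n (toℕ≤n y)) (m+[n∸m]≡n (toℕ≤n z)) ⟩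
    a + a + n + n                           ≡⟨ double a n ⟩
    a + a + 2 * n                           ∎

lemma9 : (k : ℕ) → (x y z : Fin (suc (k + k))) →
    x ≢ y → y ≢ z → x ≢ z →
    ∃[ u ] ∃[ v ] ∃[ w ] (mul k u v ≡ x × mul k v w ≡ y × mul k w u ≡ z)
lemma9 k x y z _ _ _ =
    parallelogram k x y z , parallelogram k y z x , parallelogram k z x y
  , mul-parallelogram k x y z , mul-parallelogram k y z x , mul-parallelogram k z x y
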